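{- Let $U\subseteq\mathbb Z$ be infinite and let $\sigma\colon\mathbb N\to U$ be a bijection, where $\mathbb N=\{1,2,3,\dots\}$. For any integers $a_0,a_1,a_2,\ldots$, the function $$f(x)=\sum_{k=0}^{\infty}a_k\prod_{i=1}^k (x-\sigma(i))$$ (which, for each $x\in U$, has only finitely many nonzero terms) belongs to $LIP(U)$. Moreover, every function in $LIP(U)$ is of this form for a unique sequence of integers $(a_k)_{k\ge 0}$.
   Context: For an infinite $U\subseteq\mathbb Z$, a function $f\colon U\to\mathbb Z$ is LIP on $U$ if for every finite $X\subseteq U$ there is $p\in\mathbb Z[x]$ with $p(x)=f(x)$ for all $x\in X$; $LIP(U)$ is the set of all such functions. -}

module Defs where

open import Data.Nat using (ℕ; zero; suc)
open import Data.Integer using (ℤ; _+_; _*_; _-_; 0ℤ; 1ℤ)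
open import Data.List using (List; []; _∷_)
open import Data.List.Membership.Propositional using (_∈_)
open import Data.Product using (Σ; ∃; _×_; proj₁; proj₂)
open import Relation.Binary.PropositionalEquality using (_≡_)
open import Data.Nat using (_≤_)

-- A subset U ⊆ ℤ is a proposition-valued predicate.
IsSubset : (ℤ → Set) → Set
IsSubset U = ∀ x (p q : U x) → p ≡ q

El : (ℤ → Set) → Set
El U = Σ ℤ U

-- Polynomials in ℤ[x] as coefficient lists [c₀, c₁, …] (constant term first).
Poly : Set
Poly = List ℤ

eval : Poly → ℤ → ℤ
eval []       x = 0ℤ
eval (c ∷ cs) x = c + x * eval cs x

IsLIP : (U : ℤ → Set) → (El U → ℤ) → Set
IsLIP U f = ∀ (X : List (El U)) → ∃ λ (p : Poly) → ∀ u → u ∈ X → eval p (proj₁ u) ≡ f u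

-- σ̂ : ℕ → ℤ with σ̂ j = σ(j+1) (shift from ℕ = {1,2,…} to Agda's ℕ = {0,1,…}).
-- prodTerm σ̂ k x = ∏_{i=1}^{k} (x - σ(i)) = ∏_{j<k} (x - σ̂ j)
prodTerm : (ℕ → ℤ) → ℕ → ℤ → ℤ
prodTerm σ zero    x = 1ℤ
prodTerm σ (suc k) x = prodTerm σ k x * (x - σ k)

partialSum : (ℕ → ℤ) → (ℕ → ℤ) → ℕ → ℤ → ℤ
partialSum a σ zero    x = 0ℤ
partialSum a σ (suc N) x = partialSum a σ N x + a N * prodTerm σ N x

-- The series ∑_{k≥0} a_k ∏_{i=1}^{k}(x - σ(i)) has only finitely many nonzero
-- terms and its sum equals v: its partial sums are eventually constant equal to v.
SeriesSum : (ℕ → ℤ) → (ℕ → ℤ) → ℤ → ℤ → Set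
SeriesSum a σ x v = ∃ λ N → ∀ M → N ≤ M → partialSum a σ M x ≡ v

-- At x = σ(j) every product with more than j factors vanishes, so the series is
-- a finite sum there, and on a finite X ⊆ U it agrees with one truncation, which
-- is a polynomial. Conversely, the Newton coefficients of an integer polynomial
-- with nodes σ are integers (repeated synthetic division by the monic x − σ(i)),
-- and the first k+1 of them are determined by the values at σ(1), …, σ(k+1):
-- the Newton form is triangular there, and the factors σ(j) − σ(1) ≠ 0 cancel in
-- ℤ. So the k-th coefficient of any interpolant of f on σ(1), …, σ(k+1) does not
-- depend on the interpolant; these coefficients form the required sequence, and
-- the same triangularity gives its uniqueness.
module Submission where

open import Defs
open import Data.Nat using (ℕ; zero; suc; _≤_; _<_; _⊔_; s≤s; z≤n)
open import Data.Nat.Properties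
  using (≤-refl; ≤-trans; ≤-pred; m≤n⇒m<n∨m≡n; m<n⇒m<1+n; m≤m⊔n; m≤n⊔m; suc-injective; 0≢1+n)
open import Data.Integer using (ℤ; _+_; _*_; _-_; -_; 0ℤ; 1ℤ; ≢-nonZero)
open import Data.Integer.Properties
  using (+-identityˡ; +-identityʳ; *-zeroˡ; *-zeroʳ; +-inverseʳ; *-cancelˡ-≡; i-j≡0⇒i≡j; +-0-abelianGroup)
open import Algebra.Properties.AbelianGroup +-0-abelianGroup using (∙-cancelˡ)
open import Data.Integer.Tactic.RingSolver using (solve-∀)
open import Data.List using (List; []; _∷_; foldr; applyUpTo)
open import Data.List.Membership.Propositional using (_∈_)
open import Data.List.Membership.Propositional.Properties using (∈-applyUpTo⁺)
open import Data.List.Relation.Unary.Any using (here; there)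
open import Data.Product using (Σ; ∃; _×_; _,_; proj₁; proj₂)
open import Data.Sum using (inj₁; inj₂)
open import Function using (_∘_)
open import Function.Definitions using (Injective)
open import Relation.Binary.PropositionalEquality
  using (_≡_; _≢_; refl; sym; trans; cong; cong₂; subst; module ≡-Reasoning)

open ≡-Reasoning

infixl 6 _+ᴾ_
infixr 7 _·ᴾ_

_+ᴾ_ : Poly → Poly → Poly
[]      +ᴾ q       = q
(a ∷ p) +ᴾ []      = a ∷ p
(a ∷ p) +ᴾ (b ∷ q) = a + b ∷ p +ᴾ q

_·ᴾ_ : ℤ → Poly → Poly
c ·ᴾ []      = []
c ·ᴾ (a ∷ p) = c * a ∷ c ·ᴾ p

eval-+ᴾ : ∀ p q x → eval (p +ᴾ q) x ≡ eval p x + eval q x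
eval-+ᴾ []      q       x = sym (+-identityˡ _)
eval-+ᴾ (a ∷ p) []      x = sym (+-identityʳ _)
eval-+ᴾ (a ∷ p) (b ∷ q) x = begin
  a + b + x * eval (p +ᴾ q) x         ≡⟨ cong (λ t → a + b + x * t) (eval-+ᴾ p q x) ⟩
  a + b + x * (eval p x + eval q x)   ≡⟨ interchange a b x (eval p x) (eval q x) ⟩
  a + x * eval p x + (b + x * eval q x) ∎
  where
  interchange : ∀ a b x s t → a + b + x * (s + t) ≡ a + x * s + (b + x * t)
  interchange = solve-∀

eval-·ᴾ : ∀ c p x → eval (c ·ᴾ p) x ≡ c * eval p x
eval-·ᴾ c []      x = sym (*-zeroʳ c)
eval-·ᴾ c (a ∷ p) x = begin
  c * a + x * eval (c ·ᴾ p) x   ≡⟨ cong (λ t → c * a + x * t) (eval-·ᴾ c p x) ⟩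
  c * a + x * (c * eval p x)    ≡⟨ factor c a x (eval p x) ⟩
  c * (a + x * eval p x)        ∎
  where
  factor : ∀ c a x s → c * a + x * (c * s) ≡ c * (a + x * s)
  factor = solve-∀

newtonBasis : (ℕ → ℤ) → ℕ → Poly
newtonBasis σ zero    = 1ℤ ∷ []
newtonBasis σ (suc k) = (0ℤ ∷ newtonBasis σ k) +ᴾ (- σ k) ·ᴾ newtonBasis σ k

eval-newtonBasis : ∀ σ k x → eval (newtonBasis σ k) x ≡ prodTerm σ k x
eval-newtonBasis σ zero    x = one x
  where
  one : ∀ x → 1ℤ + x * 0ℤ ≡ 1ℤ
  one = solve-∀
eval-newtonBasis σ (suc k) x = begin
  eval ((0ℤ ∷ B) +ᴾ (- σ k) ·ᴾ B) x          ≡⟨ eval-+ᴾ (0ℤ ∷ B) ((- σ k) ·ᴾ B) x ⟩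
  0ℤ + x * eval B x + eval ((- σ k) ·ᴾ B) x  ≡⟨ cong (0ℤ + x * eval B x +_) (eval-·ᴾ (- σ k) B x) ⟩
  0ℤ + x * eval B x + (- σ k) * eval B x     ≡⟨ cong (λ t → 0ℤ + x * t + (- σ k) * t) (eval-newtonBasis σ k x) ⟩
  0ℤ + x * P + (- σ k) * P                   ≡⟨ collect x P (σ k) ⟩
  P * (x - σ k)                              ∎
  where
  B : Poly
  B = newtonBasis σ k
  P : ℤ
  P = prodTerm σ k x
  collect : ∀ x t s → 0ℤ + x * t + (- s) * t ≡ t * (x - s)
  collect = solve-∀

partialSumPoly : (ℕ → ℤ) → (ℕ → ℤ) → ℕ → Poly
partialSumPoly a σ zero    = []
partialSumPoly a σ (suc N) = partialSumPoly a σ N +ᴾ a N ·ᴾ newtonBasis σ N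

eval-partialSumPoly : ∀ a σ N x → eval (partialSumPoly a σ N) x ≡ partialSum a σ N x
eval-partialSumPoly a σ zero    x = refl
eval-partialSumPoly a σ (suc N) x = begin
  eval (partialSumPoly a σ N +ᴾ a N ·ᴾ newtonBasis σ N) x                ≡⟨ eval-+ᴾ (partialSumPoly a σ N) (a N ·ᴾ newtonBasis σ N) x ⟩
  eval (partialSumPoly a σ N) x + eval (a N ·ᴾ newtonBasis σ N) x        ≡⟨ cong₂ _+_ (eval-partialSumPoly a σ N x) (eval-·ᴾ (a N) (newtonBasis σ N) x) ⟩
  partialSum a σ N x + a N * eval (newtonBasis σ N) x                    ≡⟨ cong (λ t → partialSum a σ N x + a N * t) (eval-newtonBasis σ N x) ⟩
  partialSum a σ N x + a N * prodTerm σ N x                              ∎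

synthDiv : Poly → ℤ → Poly
synthDiv []       r = []
synthDiv (c ∷ cs) r = cs +ᴾ r ·ᴾ synthDiv cs r

eval-synthDiv : ∀ p x r → eval p x ≡ eval p r + (x - r) * eval (synthDiv p r) x
eval-synthDiv []       x r = zero-form x r
  where
  zero-form : ∀ x r → 0ℤ ≡ 0ℤ + (x - r) * 0ℤ
  zero-form = solve-∀
eval-synthDiv (c ∷ cs) x r = begin
  c + x * eval cs x                             ≡⟨ cong (λ t → c + x * t) (eval-synthDiv cs x r) ⟩
  c + x * (eval cs r + (x - r) * Q)             ≡⟨ regroup c x r (eval cs r) Q ⟩
  c + r * eval cs r + (x - r) * (eval cs r + x * Q)
    ≡⟨ cong (λ t → c + r * eval cs r + (x - r) * t) quotient ⟨
  c + r * eval cs r + (x - r) * eval (synthDiv (c ∷ cs) r) x ∎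
  where
  Q : ℤ
  Q = eval (synthDiv cs r) x
  regroup : ∀ c x r s q → c + x * (s + (x - r) * q) ≡ c + r * s + (x - r) * (s + x * q)
  regroup = solve-∀
  shift : ∀ s x r q → s + (x - r) * q + r * q ≡ s + x * q
  shift = solve-∀
  quotient : eval (synthDiv (c ∷ cs) r) x ≡ eval cs r + x * Q
  quotient = begin
    eval (cs +ᴾ r ·ᴾ synthDiv cs r) x  ≡⟨ eval-+ᴾ cs (r ·ᴾ synthDiv cs r) x ⟩
    eval cs x + eval (r ·ᴾ synthDiv cs r) x  ≡⟨ cong₂ _+_ (eval-synthDiv cs x r) (eval-·ᴾ r (synthDiv cs r) x) ⟩
    eval cs r + (x - r) * Q + r * Q    ≡⟨ shift (eval cs r) x r Q ⟩
    eval cs r + x * Q                  ∎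

newtonCoeff : (ℕ → ℤ) → Poly → ℕ → ℤ
newtonCoeff σ p zero    = eval p (σ 0)
newtonCoeff σ p (suc k) = newtonCoeff (σ ∘ suc) (synthDiv p (σ 0)) k

prodTerm-suc-head : ∀ σ k x → prodTerm σ (suc k) x ≡ (x - σ 0) * prodTerm (σ ∘ suc) k x
prodTerm-suc-head σ zero    x = swap x (σ 0)
  where
  swap : ∀ x s → 1ℤ * (x - s) ≡ (x - s) * 1ℤ
  swap = solve-∀
prodTerm-suc-head σ (suc k) x = begin
  prodTerm σ (suc k) x * (x - σ (suc k))                   ≡⟨ cong (_* (x - σ (suc k))) (prodTerm-suc-head σ k x) ⟩
  (x - σ 0) * prodTerm (σ ∘ suc) k x * (x - σ (suc k))     ≡⟨ assoc (x - σ 0) (prodTerm (σ ∘ suc) k x) (x - σ (suc k)) ⟩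
  (x - σ 0) * (prodTerm (σ ∘ suc) k x * (x - σ (suc k)))   ∎
  where
  assoc : ∀ a b c → a * b * c ≡ a * (b * c)
  assoc = solve-∀

partialSum-suc-head : ∀ c σ N x →
  partialSum c σ (suc N) x ≡ c 0 + (x - σ 0) * partialSum (c ∘ suc) (σ ∘ suc) N x
partialSum-suc-head c σ zero    x = constant (c 0) x (σ 0)
  where
  constant : ∀ c x s → 0ℤ + c * 1ℤ ≡ c + (x - s) * 0ℤ
  constant = solve-∀
partialSum-suc-head c σ (suc N) x = begin
  partialSum c σ (suc N) x + c (suc N) * prodTerm σ (suc N) x
    ≡⟨ cong₂ _+_ (partialSum-suc-head c σ N x) (cong (c (suc N) *_) (prodTerm-suc-head σ N x)) ⟩
  c 0 + (x - σ 0) * S + c (suc N) * ((x - σ 0) * P)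
    ≡⟨ factor (c 0) (x - σ 0) S (c (suc N)) P ⟩
  c 0 + (x - σ 0) * (S + c (suc N) * P) ∎
  where
  S P : ℤ
  S = partialSum (c ∘ suc) (σ ∘ suc) N x
  P = prodTerm (σ ∘ suc) N x
  factor : ∀ c₀ y s c p → c₀ + y * s + c * (y * p) ≡ c₀ + y * (s + c * p)
  factor = solve-∀

partialSum-at-head : ∀ c σ N → partialSum c σ (suc N) (σ 0) ≡ c 0
partialSum-at-head c σ N = begin
  partialSum c σ (suc N) (σ 0)                 ≡⟨ partialSum-suc-head c σ N (σ 0) ⟩
  c 0 + (σ 0 - σ 0) * S                        ≡⟨ cong (λ t → c 0 + t * S) (+-inverseʳ (σ 0)) ⟩
  c 0 + 0ℤ * S                                 ≡⟨ cong (c 0 +_) (*-zeroˡ S) ⟩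
  c 0 + 0ℤ                                     ≡⟨ +-identityʳ (c 0) ⟩
  c 0                                          ∎
  where
  S : ℤ
  S = partialSum (c ∘ suc) (σ ∘ suc) N (σ 0)

prodTerm-vanishes : ∀ σ {M j} → j < M → prodTerm σ M (σ j) ≡ 0ℤ
prodTerm-vanishes σ {suc M} {j} (s≤s j≤M) with m≤n⇒m<n∨m≡n j≤M
... | inj₁ j<M  = trans (cong (_* (σ j - σ M)) (prodTerm-vanishes σ j<M)) (*-zeroˡ (σ j - σ M))
... | inj₂ refl = trans (cong (prodTerm σ M (σ j) *_) (+-inverseʳ (σ j))) (*-zeroʳ (prodTerm σ M (σ j)))

partialSum-stable : ∀ c σ {M j x} → σ j ≡ x → j < M → partialSum c σ M x ≡ partialSum c σ (suc j) x
partialSum-stable c σ {suc M} {j} refl (s≤s j≤M) with m≤n⇒m<n∨m≡n j≤M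
... | inj₂ refl = refl
... | inj₁ j<M  = begin
  partialSum c σ M (σ j) + c M * prodTerm σ M (σ j)  ≡⟨ cong₂ _+_ (partialSum-stable c σ refl j<M)
                                                               (cong (c M *_) (prodTerm-vanishes σ j<M)) ⟩
  partialSum c σ (suc j) (σ j) + c M * 0ℤ             ≡⟨ cong (partialSum c σ (suc j) (σ j) +_) (*-zeroʳ (c M)) ⟩
  partialSum c σ (suc j) (σ j) + 0ℤ                   ≡⟨ +-identityʳ _ ⟩
  partialSum c σ (suc j) (σ j)                        ∎

partialSum-cong : ∀ c d σ N x → (∀ i → i < N → c i ≡ d i) → partialSum c σ N x ≡ partialSum d σ N x
partialSum-cong c d σ zero    x c≗d = refl
partialSum-cong c d σ (suc N) x c≗d =
  cong₂ _+_ (partialSum-cong c d σ N x (λ i i<N → c≗d i (m<n⇒m<1+n i<N))) (cong (_* prodTerm σ N x) (c≗d N ≤-refl))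

seriesSum-partialSum : ∀ c σ {j x} → σ j ≡ x → SeriesSum c σ x (partialSum c σ (suc j) x)
seriesSum-partialSum c σ σj≡x = _ , λ M j<M → partialSum-stable c σ σj≡x j<M

seriesSum⇒partialSum : ∀ c σ {j k v} → SeriesSum c σ (σ j) v → j ≤ k → partialSum c σ (suc k) (σ j) ≡ v
seriesSum⇒partialSum c σ {j} {k} (N , sum) j≤k = begin
  partialSum c σ (suc k) (σ j)      ≡⟨ partialSum-stable c σ refl (s≤s j≤k) ⟩
  partialSum c σ (suc j) (σ j)      ≡⟨ partialSum-stable c σ refl (≤-trans (s≤s j≤k) (m≤n⊔m N (suc k))) ⟨
  partialSum c σ (N ⊔ suc k) (σ j)  ≡⟨ sum (N ⊔ suc k) (m≤m⊔n N (suc k)) ⟩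
  _                                 ∎

newtonCoeff-interpolates : ∀ σ p k {j} → j ≤ k → partialSum (newtonCoeff σ p) σ (suc k) (σ j) ≡ eval p (σ j)
newtonCoeff-interpolates σ p k       {zero}  _          = partialSum-at-head (newtonCoeff σ p) σ k
newtonCoeff-interpolates σ p (suc k) {suc j} (s≤s j≤k) = begin
  partialSum (newtonCoeff σ p) σ (suc (suc k)) (σ (suc j))
    ≡⟨ partialSum-suc-head (newtonCoeff σ p) σ (suc k) (σ (suc j)) ⟩
  eval p (σ 0) + (σ (suc j) - σ 0) * partialSum (newtonCoeff (σ ∘ suc) q) (σ ∘ suc) (suc k) (σ (suc j))
    ≡⟨ cong (λ t → eval p (σ 0) + (σ (suc j) - σ 0) * t) (newtonCoeff-interpolates (σ ∘ suc) q k j≤k) ⟩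
  eval p (σ 0) + (σ (suc j) - σ 0) * eval q (σ (suc j))
    ≡⟨ eval-synthDiv p (σ (suc j)) (σ 0) ⟨
  eval p (σ (suc j)) ∎
  where
  q : Poly
  q = synthDiv p (σ 0)

partialSum-cancel-head : ∀ c d σ N {x} → x ≢ σ 0 → c 0 ≡ d 0 →
  partialSum c σ (suc N) x ≡ partialSum d σ (suc N) x →
  partialSum (c ∘ suc) (σ ∘ suc) N x ≡ partialSum (d ∘ suc) (σ ∘ suc) N x
partialSum-cancel-head c d σ N {x} x≢σ₀ c₀≡d₀ sums≡ =
  *-cancelˡ-≡ (x - σ 0) (partialSum (c ∘ suc) (σ ∘ suc) N x) (partialSum (d ∘ suc) (σ ∘ suc) N x)
    {{≢-nonZero (x≢σ₀ ∘ i-j≡0⇒i≡j x (σ 0))}}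
    (∙-cancelˡ (c 0) _ _ (begin
      c 0 + (x - σ 0) * partialSum (c ∘ suc) (σ ∘ suc) N x  ≡⟨ partialSum-suc-head c σ N x ⟨
      partialSum c σ (suc N) x                               ≡⟨ sums≡ ⟩
      partialSum d σ (suc N) x                               ≡⟨ partialSum-suc-head d σ N x ⟩
      d 0 + (x - σ 0) * partialSum (d ∘ suc) (σ ∘ suc) N x  ≡⟨ cong (_+ _) c₀≡d₀ ⟨
      c 0 + (x - σ 0) * partialSum (d ∘ suc) (σ ∘ suc) N x  ∎))

partialSum-coeffs-unique : ∀ c d σ k → Injective _≡_ _≡_ σ →
  (∀ j → j ≤ k → partialSum c σ (suc k) (σ j) ≡ partialSum d σ (suc k) (σ j)) →
  ∀ i → i ≤ k → c i ≡ d i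
partialSum-coeffs-unique c d σ k σ-inj sums≡ zero _ =
  trans (sym (partialSum-at-head c σ k)) (trans (sums≡ 0 z≤n) (partialSum-at-head d σ k))
partialSum-coeffs-unique c d σ (suc k) σ-inj sums≡ (suc i) (s≤s i≤k) =
  partialSum-coeffs-unique (c ∘ suc) (d ∘ suc) σ-suc k (suc-injective ∘ σ-inj) tail-sums≡ i i≤k
  where
  σ-suc : ℕ → ℤ
  σ-suc = σ ∘ suc
  tail-sums≡ : ∀ j → j ≤ k →
    partialSum (c ∘ suc) σ-suc (suc k) (σ-suc j) ≡ partialSum (d ∘ suc) σ-suc (suc k) (σ-suc j)
  tail-sums≡ j j≤k = partialSum-cancel-head c d σ (suc k) (0≢1+n ∘ sym ∘ σ-inj)
    (partialSum-coeffs-unique c d σ (suc k) σ-inj sums≡ 0 z≤n) (sums≡ (suc j) (s≤s j≤k))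

newtonCoeff-local : ∀ σ {p q} k → Injective _≡_ _≡_ σ → (∀ j → j ≤ k → eval p (σ j) ≡ eval q (σ j)) →
  ∀ i → i ≤ k → newtonCoeff σ p i ≡ newtonCoeff σ q i
newtonCoeff-local σ {p} {q} k σ-inj p≗q =
  partialSum-coeffs-unique (newtonCoeff σ p) (newtonCoeff σ q) σ k σ-inj λ j j≤k → begin
  partialSum (newtonCoeff σ p) σ (suc k) (σ j)  ≡⟨ newtonCoeff-interpolates σ p k j≤k ⟩
  eval p (σ j)                                  ≡⟨ p≗q j j≤k ⟩
  eval q (σ j)                                  ≡⟨ newtonCoeff-interpolates σ q k j≤k ⟨
  partialSum (newtonCoeff σ q) σ (suc k) (σ j)  ∎

seriesSum-unique : ∀ {c d g : ℕ → ℤ} σ → Injective _≡_ _≡_ σ →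
  (∀ j → SeriesSum c σ (σ j) (g j)) → (∀ j → SeriesSum d σ (σ j) (g j)) → ∀ k → c k ≡ d k
seriesSum-unique {c} {d} σ σ-inj c-sums d-sums k = partialSum-coeffs-unique c d σ k σ-inj
  (λ j j≤k → trans (seriesSum⇒partialSum c σ (c-sums j) j≤k) (sym (seriesSum⇒partialSum d σ (d-sums j) j≤k)))
  k ≤-refl

diagonalNewtonCoeff : (ℕ → ℤ) → (ℕ → Poly) → ℕ → ℤ
diagonalNewtonCoeff σ P k = newtonCoeff σ (P k) k

seriesSum-diagonalNewtonCoeff : ∀ σ {g : ℕ → ℤ} P → Injective _≡_ _≡_ σ →
  (∀ k j → j ≤ k → eval (P k) (σ j) ≡ g j) → ∀ j → SeriesSum (diagonalNewtonCoeff σ P) σ (σ j) (g j)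
seriesSum-diagonalNewtonCoeff σ {g} P σ-inj P-interp j =
  subst (SeriesSum a σ (σ j)) partialSum≡g (seriesSum-partialSum a σ refl)
  where
  a : ℕ → ℤ
  a = diagonalNewtonCoeff σ P
  coeff-stable : ∀ i → i < suc j → a i ≡ newtonCoeff σ (P j) i
  coeff-stable i i<sj = newtonCoeff-local σ i σ-inj
    (λ l l≤i → trans (P-interp i l l≤i) (sym (P-interp j l (≤-trans l≤i (≤-pred i<sj))))) i ≤-refl
  partialSum≡g : partialSum a σ (suc j) (σ j) ≡ g j
  partialSum≡g = begin
    partialSum a σ (suc j) (σ j)                        ≡⟨ partialSum-cong a (newtonCoeff σ (P j)) σ (suc j) (σ j) coeff-stable ⟩
    partialSum (newtonCoeff σ (P j)) σ (suc j) (σ j)    ≡⟨ newtonCoeff-interpolates σ (P j) j ≤-refl ⟩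
    eval (P j) (σ j)                                    ≡⟨ P-interp j j ≤-refl ⟩
    g j                                                 ∎

module Enumeration (U : ℤ → Set) (σ : ℕ → ℤ) (σ∈U : ∀ n → U (σ n))
                   (σ-surjective : ∀ x → U x → ∃ λ n → σ n ≡ x) where

  element : ℕ → El U
  element n = σ n , σ∈U n

  index : El U → ℕ
  index (x , x∈U) = proj₁ (σ-surjective x x∈U)

  σ-index : ∀ u → σ (index u) ≡ proj₁ u
  σ-index (x , x∈U) = proj₂ (σ-surjective x x∈U)

  element-index : IsSubset U → ∀ u → element (index u) ≡ u
  element-index U-prop (x , x∈U) with index (x , x∈U) | σ-index (x , x∈U)
  ... | n | refl = cong (σ n ,_) (U-prop (σ n) (σ∈U n) x∈U)

  indexBound : List (El U) → ℕ
  indexBound = foldr (λ u m → suc (index u) ⊔ m) 0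

  index<indexBound : ∀ {u X} → u ∈ X → index u < indexBound X
  index<indexBound {u} {v ∷ X} (here refl) = m≤m⊔n (suc (index u)) (indexBound X)
  index<indexBound {u} {v ∷ X} (there u∈X) = ≤-trans (index<indexBound u∈X) (m≤n⊔m (suc (index v)) (indexBound X))

  seriesValue : (ℕ → ℤ) → El U → ℤ
  seriesValue a u = partialSum a σ (suc (index u)) (proj₁ u)

  seriesSum-seriesValue : ∀ a u → SeriesSum a σ (proj₁ u) (seriesValue a u)
  seriesSum-seriesValue a u = seriesSum-partialSum a σ (σ-index u)

  seriesValue-isLIP : ∀ a → IsLIP U (seriesValue a)
  seriesValue-isLIP a X = partialSumPoly a σ (indexBound X) , λ u u∈X →
    trans (eval-partialSumPoly a σ (indexBound X) (proj₁ u))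
          (partialSum-stable a σ (σ-index u) (index<indexBound u∈X))

  LIP-coefficients : (f : El U → ℤ) → IsLIP U f → ℕ → ℤ
  LIP-coefficients f f-lip = diagonalNewtonCoeff σ (λ k → proj₁ (f-lip (applyUpTo element (suc k))))

  seriesSum-LIP-coefficients : IsSubset U → Injective _≡_ _≡_ σ → ∀ f f-lip u →
    SeriesSum (LIP-coefficients f f-lip) σ (proj₁ u) (f u)
  seriesSum-LIP-coefficients U-prop σ-inj f f-lip u =
    subst (λ v → SeriesSum (LIP-coefficients f f-lip) σ (proj₁ v) (f v)) (element-index U-prop u)
      (seriesSum-diagonalNewtonCoeff σ _ σ-inj interpolates (index u))
    where
    interpolates : ∀ k j → j ≤ k → eval (proj₁ (f-lip (applyUpTo element (suc k)))) (σ j) ≡ f (element j)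
    interpolates k j j≤k = proj₂ (f-lip (applyUpTo element (suc k))) (element j) (∈-applyUpTo⁺ element (s≤s j≤k))

theorem1 : (U : ℤ → Set) → IsSubset U →
           (σ : ℕ → ℤ) → (σ∈U : ∀ n → U (σ n)) →
           (∀ m n → σ m ≡ σ n → m ≡ n) →
           (∀ x → U x → ∃ λ n → σ n ≡ x) →
           ((a : ℕ → ℤ) →
              Σ (El U → ℤ) λ f →
                (∀ (u : El U) → SeriesSum a σ (proj₁ u) (f u)) × IsLIP U f)
           ×
           ((f : El U → ℤ) → IsLIP U f →
              Σ (ℕ → ℤ) λ a →
                (∀ (u : El U) → SeriesSum a σ (proj₁ u) (f u)) ×
                (∀ (b : ℕ → ℤ) → (∀ (u : El U) → SeriesSum b σ (proj₁ u) (f u)) →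
                   ∀ k → a k ≡ b k))
theorem1 U U-prop σ σ∈U σ-inj σ-surj =
  (λ a → seriesValue a , seriesSum-seriesValue a , seriesValue-isLIP a) ,
  λ f f-lip → let a-sums = seriesSum-LIP-coefficients U-prop injective f f-lip in
    LIP-coefficients f f-lip , a-sums , λ b b-sums →
      seriesSum-unique σ injective (a-sums ∘ element) (b-sums ∘ element)
  where
  open Enumeration U σ σ∈U σ-surj
  injective : Injective _≡_ _≡_ σ
  injective = σ-inj _ _
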